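{- Let $A'$ be an $m\times n$ rational matrix, $C=\{x\in\mathbb{R}^n_+ : A'x=0\}$, $K=C\cap\mathbb{Z}^n$, and let $H$ be the unique minimal Hilbert basis of $K$. If $v\in H$ satisfies $v\le e$, then there is no $u\in H$ with $u\neq v$ and $supp(v)\subseteq supp(u)$.
   Context: A Hilbert basis of $K$ is a finite subset $B\subseteq K$ such that every element of $K$ is a non-negative integer combination of elements of $B$; since $C$ is a pointed rational cone, there is a unique inclusion-minimal Hilbert basis $H$, contained in every Hilbert basis. For a non-negative vector $x$, $supp(x)=\{i : x_i>0\}$. $e$ is the all-ones vector and $\le$ is componentwise. -}

module Defs where

open import Data.Nat using (ℕ; zero; suc; _≤_; _<_)
open import Data.Integer using (+_)
open import Data.Rational using (ℚ; 0ℚ; _/_) renaming (_+_ to _+ℚ_; _*_ to _*ℚ_)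
open import Data.Fin using (Fin)
import Data.Fin as Fin
import Data.Nat
import Data.Vec
open import Data.Vec using (Vec; []; _∷_; lookup; zipWith; replicate; foldr)
open import Data.List using (List; []; _∷_; length)
open import Data.List.Relation.Unary.All using (All)
open import Data.List.Membership.Propositional using (_∈_)
open import Data.List.Relation.Binary.Subset.Propositional using (_⊆_)
open import Data.Product using (Σ; ∃)
open import Relation.Binary.PropositionalEquality using (_≡_)

Matrix : ℕ → ℕ → Set
Matrix m n = Vec (Vec ℚ n) m

ℕ→ℚ : ℕ → ℚ
ℕ→ℚ k = (+ k) / 1

dot : ∀ {n} → Vec ℚ n → Vec ℕ n → ℚ
dot r x = foldr _ _+ℚ_ 0ℚ (zipWith (λ a k → a *ℚ ℕ→ℚ k) r x)

-- x ∈ K = C ∩ ℤⁿ, where C = {x ∈ ℝⁿ₊ : A' x = 0}; integer points of C are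
-- exactly the non-negative integer vectors x with A' x = 0.
InK : ∀ {m n} → Matrix m n → Vec ℕ n → Set
InK {m} A x = ∀ (i : Fin m) → dot (lookup A i) x ≡ 0ℚ

comb : ∀ {n} (B : List (Vec ℕ n)) → (Fin (length B) → ℕ) → Vec ℕ n
comb {n} [] c = replicate n 0
comb (b ∷ B) c =
  zipWith Data.Nat._+_ (Data.Vec.map (λ k → c Fin.zero Data.Nat.* k) b) (comb B (λ i → c (Fin.suc i)))

IsHilbertBasis : ∀ {m n} → Matrix m n → List (Vec ℕ n) → Set
IsHilbertBasis A B =
  All (InK A) B × (∀ x → InK A x → Σ (Fin (length B) → ℕ) λ c → x ≡ comb B c)
  where open import Data.Product using (_×_)

IsMinimalHilbertBasis : ∀ {m n} → Matrix m n → List (Vec ℕ n) → Set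
IsMinimalHilbertBasis A H =
  IsHilbertBasis A H × (∀ B → B ⊆ H → IsHilbertBasis A B → H ⊆ B)
  where open import Data.Product using (_×_)

SuppSub : ∀ {n} → Vec ℕ n → Vec ℕ n → Set
SuppSub {n} v u = ∀ (i : Fin n) → 0 < lookup v i → 0 < lookup u i

LeOnes : ∀ {n} → Vec ℕ n → Set
LeOnes {n} v = ∀ (i : Fin n) → lookup v i ≤ 1

{-# OPTIONS --safe #-}
-- Since v ≤ e and supp v ⊆ supp u, v ≤ u componentwise, so u = v + w with w = u − v ∈ K.
-- Elements of a minimal Hilbert basis are nonzero and irreducible in K: if h = x + y with
-- x, y ∈ K, write x and y in the basis; if either uses h then the other vanishes, and
-- otherwise h is a combination of the remaining elements, which then still form a Hilbert
-- basis. Hence v = 0 or w = 0, and both are impossible.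
module Submission where

open import Defs
open import Data.Nat using (ℕ)
open import Data.Vec using (Vec)
open import Data.List using (List)
open import Data.List.Membership.Propositional using (_∈_)
open import Relation.Binary.PropositionalEquality using (_≢_)
open import Relation.Nullary using (¬_)
open import Data.Product using (Σ; _×_)

open import Algebra.Bundles using (CommutativeMonoid)
open import Algebra.Structures using (IsCommutativeMonoid)
import Algebra.Properties.CommutativeSemigroup
open import Data.Empty using (⊥-elim)
open import Data.Fin using (Fin; zero; suc)
open import Data.Integer using (+_)
import Data.Integer as ℤ
import Data.Integer.Properties as ℤ
open import Data.List using ([]; _∷_; filter; length)
open import Data.List.Membership.Propositional using (_∉_)
open import Data.List.Relation.Binary.Subset.Propositional using (_⊆_)
open import Data.List.Membership.Propositional.Properties using (∈-filter⁻)
import Data.List.Relation.Unary.All as All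
open import Data.List.Relation.Unary.All.Properties using (filter⁺)
open import Data.List.Relation.Unary.Any using (here; there)
open import Data.Nat using (zero; suc; _+_; _*_; _∸_; _≤_; _<_; z≤n; s≤s)
import Data.Nat.Properties as ℕ
open import Data.Nat.Coprimality using (1-coprimeTo)
import Data.Nat.Coprimality as Coprime
open import Data.Product using (_,_; proj₁; proj₂; ∃; Σ-syntax)
open import Data.Rational using (ℚ; 0ℚ; mkℚ; _/_) renaming (_+_ to _+ℚ_; _*_ to _*ℚ_)
import Data.Rational.Properties as ℚ
open import Data.Sum using (_⊎_; inj₁; inj₂; [_,_])
open import Data.Vec using ([]; _∷_; lookup; zipWith; replicate; map)
import Data.Vec.Properties as Vec
open import Function using (_∘_)
open import Relation.Binary.PropositionalEquality
  using (_≡_; refl; sym; trans; cong; cong₂; subst; module ≡-Reasoning)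
open import Relation.Binary.PropositionalEquality.Algebra using (isMagma)
open import Relation.Nullary using (Dec; yes; no; ¬?)

private
  variable
    m n : ℕ
    x y z h : Vec ℕ n
    B : List (Vec ℕ n)

infixl 6 _⊕_
infixl 7 _⊙_

_⊕_ : Vec ℕ n → Vec ℕ n → Vec ℕ n
_⊕_ = zipWith _+_

_⊙_ : ℕ → Vec ℕ n → Vec ℕ n
k ⊙ x = map (k *_) x

0ᵥ : Vec ℕ n
0ᵥ = replicate _ 0

⊕-comm : (x y : Vec ℕ n) → x ⊕ y ≡ y ⊕ x
⊕-comm = Vec.zipWith-comm ℕ.+-comm

⊕-identityʳ : (x : Vec ℕ n) → x ⊕ 0ᵥ ≡ x
⊕-identityʳ = Vec.zipWith-identityʳ ℕ.+-identityʳ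

⊕-isCommutativeMonoid : IsCommutativeMonoid _≡_ (_⊕_ {n}) 0ᵥ
⊕-isCommutativeMonoid = record
  { isMonoid = record
    { isSemigroup = record { isMagma = isMagma _⊕_ ; assoc = Vec.zipWith-assoc ℕ.+-assoc }
    ; identity = Vec.zipWith-identityˡ ℕ.+-identityˡ , ⊕-identityʳ
    }
  ; comm = ⊕-comm
  }

⊕-commutativeMonoid : ℕ → CommutativeMonoid _ _
⊕-commutativeMonoid n = record { isCommutativeMonoid = ⊕-isCommutativeMonoid {n} }

module ⊕-Properties {n : ℕ} where
  open CommutativeMonoid (⊕-commutativeMonoid n) public
    using () renaming (assoc to ⊕-assoc; identityˡ to ⊕-identityˡ)
  open import Algebra.Properties.CommutativeSemigroup
    (CommutativeMonoid.commutativeSemigroup (⊕-commutativeMonoid n)) public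
    using (interchange; x∙yz≈y∙xz)
open ⊕-Properties

⊙-zeroˡ : (x : Vec ℕ n) → 0 ⊙ x ≡ 0ᵥ
⊙-zeroˡ x = Vec.map-const x 0

⊙-suc : (k : ℕ) (x : Vec ℕ n) → suc k ⊙ x ≡ x ⊕ k ⊙ x
⊙-suc k [] = refl
⊙-suc k (a ∷ x) = cong (a + k * a ∷_) (⊙-suc k x)

⊙-identityˡ : (x : Vec ℕ n) → 1 ⊙ x ≡ x
⊙-identityˡ x = trans (Vec.map-cong ℕ.*-identityˡ x) (Vec.map-id x)

⊙-distribʳ : (k l : ℕ) (x : Vec ℕ n) → (k + l) ⊙ x ≡ k ⊙ x ⊕ l ⊙ x
⊙-distribʳ k l [] = refl
⊙-distribʳ k l (a ∷ x) = cong₂ _∷_ (ℕ.*-distribʳ-+ a k l) (⊙-distribʳ k l x)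

0⊙x⊕y≡y : (x y : Vec ℕ n) → 0 ⊙ x ⊕ y ≡ y
0⊙x⊕y≡y x y = trans (cong (_⊕ y) (⊙-zeroˡ x)) (⊕-identityˡ y)

x≡x⊕y⊕z⇒z≡0 : x ≡ x ⊕ y ⊕ z → z ≡ 0ᵥ
x≡x⊕y⊕z⇒z≡0 {x = []} {[]} {[]} _ = refl
x≡x⊕y⊕z⇒z≡0 {x = a ∷ x} {b ∷ y} {c ∷ z} eq =
  cong₂ _∷_ (ℕ.m+n≡0⇒n≡0 b (ℕ.+-cancelˡ-≡ a (b + c) 0 a+[b+c]≡a+0))
            (x≡x⊕y⊕z⇒z≡0 (Vec.∷-injectiveʳ eq))
  where
  a+[b+c]≡a+0 : a + (b + c) ≡ a + 0
  a+[b+c]≡a+0 = trans (sym (ℕ.+-assoc a b c))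
                      (trans (sym (Vec.∷-injectiveˡ eq)) (sym (ℕ.+-identityʳ a)))

x≡[1+k]x⊕y⊕z⇒z≡0 : (k : ℕ) → x ≡ suc k ⊙ x ⊕ y ⊕ z → z ≡ 0ᵥ
x≡[1+k]x⊕y⊕z⇒z≡0 {x = x} {y} {z} k eq = x≡x⊕y⊕z⇒z≡0 (begin
  x                    ≡⟨ eq ⟩
  suc k ⊙ x ⊕ y ⊕ z    ≡⟨ cong (λ t → t ⊕ y ⊕ z) (⊙-suc k x) ⟩
  x ⊕ k ⊙ x ⊕ y ⊕ z    ≡⟨ cong (_⊕ z) (⊕-assoc x (k ⊙ x) y) ⟩
  x ⊕ (k ⊙ x ⊕ y) ⊕ z  ∎)
  where open ≡-Reasoning

≤-pointwise⇒∃⊕ : (x y : Vec ℕ n) → (∀ i → lookup x i ≤ lookup y i) → ∃ λ z → y ≡ x ⊕ z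
≤-pointwise⇒∃⊕ [] [] _ = [] , refl
≤-pointwise⇒∃⊕ (a ∷ x) (b ∷ y) x≤y with ≤-pointwise⇒∃⊕ x y (x≤y ∘ suc)
... | z , refl = b ∸ a ∷ z , cong (_∷ x ⊕ z) (sym (ℕ.m+[n∸m]≡n (x≤y zero)))

data IsCombination (B : List (Vec ℕ n)) : Vec ℕ n → Set where
  combination : (c : Fin (length B) → ℕ) → IsCombination B (comb B c)

coefficients⇒isCombination : Σ[ c ∈ (Fin (length B) → ℕ) ] x ≡ comb B c → IsCombination B x
coefficients⇒isCombination (c , refl) = combination c

isCombination⇒coefficients : IsCombination B x → Σ[ c ∈ (Fin (length B) → ℕ) ] x ≡ comb B c
isCombination⇒coefficients (combination c) = c , refl

comb-zero : (B : List (Vec ℕ n)) → comb B (λ _ → 0) ≡ 0ᵥ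
comb-zero [] = refl
comb-zero (b ∷ B) = trans (0⊙x⊕y≡y b _) (comb-zero B)

comb-+ : (B : List (Vec ℕ n)) (c d : Fin (length B) → ℕ) →
         comb B (λ j → c j + d j) ≡ comb B c ⊕ comb B d
comb-+ [] c d = sym (⊕-identityʳ 0ᵥ)
comb-+ (b ∷ B) c d = trans (cong₂ _⊕_ (⊙-distribʳ (c zero) (d zero) b) (comb-+ B (c ∘ suc) (d ∘ suc)))
                          (interchange _ _ _ _)

isCombination-0ᵥ : IsCombination B 0ᵥ
isCombination-0ᵥ {B = B} = subst (IsCombination B) (comb-zero B) (combination _)

isCombination-⊕ : IsCombination B x → IsCombination B y → IsCombination B (x ⊕ y)
isCombination-⊕ {B = B} (combination c) (combination d) =
  subst (IsCombination B) (comb-+ B c d) (combination _)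

isCombination-⊙ : (k : ℕ) → IsCombination B x → IsCombination B (k ⊙ x)
isCombination-⊙ {B = B} {x = x} zero _ = subst (IsCombination B) (sym (⊙-zeroˡ x)) isCombination-0ᵥ
isCombination-⊙ {B = B} {x = x} (suc k) xc =
  subst (IsCombination B) (sym (⊙-suc k x)) (isCombination-⊕ xc (isCombination-⊙ k xc))

isCombination-∷ : (k : ℕ) → IsCombination B y → IsCombination (h ∷ B) (k ⊙ h ⊕ y)
isCombination-∷ k (combination d) = combination λ { zero → k ; (suc j) → d j }

isCombination-∈ : x ∈ B → IsCombination B x
isCombination-∈ {B = b ∷ B} (here refl) =
  subst (IsCombination (b ∷ B)) (trans (cong (_⊕ 0ᵥ) (⊙-identityˡ b)) (⊕-identityʳ b))
    (isCombination-∷ 1 isCombination-0ᵥ)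
isCombination-∈ {x = x} {B = h ∷ B} (there x∈B) =
  subst (IsCombination (h ∷ B)) (0⊙x⊕y≡y h x) (isCombination-∷ 0 (isCombination-∈ x∈B))

_≟ᵥ_ : (x y : Vec ℕ n) → Dec (x ≡ y)
_≟ᵥ_ = Vec.≡-dec ℕ._≟_

_≢?_ : (x y : Vec ℕ n) → Dec (x ≢ y)
x ≢? y = ¬? (x ≟ᵥ y)

_∖_ : List (Vec ℕ n) → Vec ℕ n → List (Vec ℕ n)
B ∖ h = filter (_≢? h) B

∖-⊆ : (B : List (Vec ℕ n)) → B ∖ h ⊆ B
∖-⊆ {h = h} B = proj₁ ∘ ∈-filter⁻ (_≢? h) {xs = B}

∉-∖ : (B : List (Vec ℕ n)) → h ∉ B ∖ h
∉-∖ {h = h} B h∈B∖h = proj₂ (∈-filter⁻ (_≢? h) {xs = B} h∈B∖h) refl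

split-off : (h : Vec ℕ n) → IsCombination B x →
            Σ[ k ∈ ℕ ] Σ[ y ∈ Vec ℕ n ] x ≡ k ⊙ h ⊕ y × IsCombination (B ∖ h) y
split-off {B = []} {x = x} h xc = 0 , x , sym (0⊙x⊕y≡y h x) , xc
-- Matching on b ≟ᵥ h also reduces the filter in (b ∷ B) ∖ h.
split-off {B = b ∷ B} h (combination c) with split-off h (combination {B = B} (c ∘ suc)) | b ≟ᵥ h
... | k , y , eq , yc | yes refl = c zero + k , y , x≡ , yc
  where
  open ≡-Reasoning
  x≡ : c zero ⊙ b ⊕ comb B (c ∘ suc) ≡ (c zero + k) ⊙ b ⊕ y
  x≡ = begin
    c zero ⊙ b ⊕ comb B (c ∘ suc) ≡⟨ cong (c zero ⊙ b ⊕_) eq ⟩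
    c zero ⊙ b ⊕ (k ⊙ b ⊕ y)      ≡⟨ ⊕-assoc _ _ _ ⟨
    c zero ⊙ b ⊕ k ⊙ b ⊕ y        ≡⟨ cong (_⊕ y) (⊙-distribʳ (c zero) k b) ⟨
    (c zero + k) ⊙ b ⊕ y          ∎
... | k , y , eq , yc | no b≢h =
  k , c zero ⊙ b ⊕ y , trans (cong (c zero ⊙ b ⊕_) eq) (x∙yz≈y∙xz _ _ _) ,
  isCombination-∷ (c zero) yc

∖-isHilbertBasis : (A : Matrix m n) {H : List (Vec ℕ n)} →
                   IsHilbertBasis A H → IsCombination (H ∖ h) h → IsHilbertBasis A (H ∖ h)
∖-isHilbertBasis {h = h} A {H} (H⊆K , spans) hc = filter⁺ (_≢? h) H⊆K , spans∖
  where
  spans∖ : ∀ x → InK A x → Σ[ c ∈ (Fin (length (H ∖ h)) → ℕ) ] x ≡ comb (H ∖ h) c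
  spans∖ x xK =
    let k , y , x≡k⊙h⊕y , yc = split-off h (coefficients⇒isCombination {B = H} (spans x xK))
    in isCombination⇒coefficients
         (subst (IsCombination (H ∖ h)) (sym x≡k⊙h⊕y) (isCombination-⊕ (isCombination-⊙ k hc) yc))

minimal⇒¬isCombination-∖ : (A : Matrix m n) {H : List (Vec ℕ n)} →
                           IsMinimalHilbertBasis A H → h ∈ H → ¬ IsCombination (H ∖ h) h
minimal⇒¬isCombination-∖ A {H} (isHB , minimal) h∈H hc =
  ∉-∖ H (minimal (H ∖ _) (∖-⊆ H) (∖-isHilbertBasis A isHB hc) h∈H)

minimal⇒0ᵥ∉ : (A : Matrix m n) {H : List (Vec ℕ n)} → IsMinimalHilbertBasis A H → 0ᵥ ∉ H
minimal⇒0ᵥ∉ A {H} isMHB 0∈H = minimal⇒¬isCombination-∖ A isMHB 0∈H (isCombination-0ᵥ {B = H ∖ 0ᵥ})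

minimal⇒irreducible : (A : Matrix m n) {H : List (Vec ℕ n)} → IsMinimalHilbertBasis A H → h ∈ H →
                      InK A x → InK A y → h ≡ x ⊕ y → x ≡ 0ᵥ ⊎ y ≡ 0ᵥ
minimal⇒irreducible {h = h} {x = x} {y = y} A {H} isMHB@((_ , spans) , _) h∈H xK yK h≡x⊕y
  with split-off h (coefficients⇒isCombination {B = H} (spans x xK))
     | split-off h (coefficients⇒isCombination {B = H} (spans y yK))
... | suc k , x′ , refl , _ | _ = inj₂ (x≡[1+k]x⊕y⊕z⇒z≡0 k h≡x⊕y)
... | _ | suc l , y′ , refl , _ = inj₁ (x≡[1+k]x⊕y⊕z⇒z≡0 l (trans h≡x⊕y (⊕-comm x _)))
... | zero , x′ , refl , x′c | zero , y′ , refl , y′c =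
  ⊥-elim (minimal⇒¬isCombination-∖ A isMHB h∈H
           (subst (IsCombination (H ∖ h)) (sym h≡x′⊕y′) (isCombination-⊕ x′c y′c)))
  where
  h≡x′⊕y′ : h ≡ x′ ⊕ y′
  h≡x′⊕y′ = trans h≡x⊕y (cong₂ _⊕_ (0⊙x⊕y≡y h x′) (0⊙x⊕y≡y h y′))

ℕ→ℚ-+ : (a b : ℕ) → ℕ→ℚ (a + b) ≡ ℕ→ℚ a +ℚ ℕ→ℚ b
ℕ→ℚ-+ a b = begin
  + (a + b) / 1
    ≡⟨ ℚ./-cong (cong₂ ℤ._+_ (ℤ.*-identityʳ (+ a)) (ℤ.*-identityʳ (+ b))) refl ⟨
  (+ a ℤ.* + 1 ℤ.+ + b ℤ.* + 1) / (1 * 1)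
    ≡⟨⟩
  integral a +ℚ integral b
    ≡⟨ cong₂ _+ℚ_ (ℚ.↥p/↧p≡p (integral a)) (ℚ.↥p/↧p≡p (integral b)) ⟨
  ℕ→ℚ a +ℚ ℕ→ℚ b ∎
  where
  open ≡-Reasoning
  integral : ℕ → ℚ
  integral k = mkℚ (+ k) 0 (Coprime.sym (1-coprimeTo k))

dot-⊕ : (r : Vec ℚ n) (x y : Vec ℕ n) → dot r (x ⊕ y) ≡ dot r x +ℚ dot r y
dot-⊕ [] [] [] = sym (ℚ.+-identityˡ 0ℚ)
dot-⊕ (a ∷ r) (b ∷ x) (c ∷ y) = begin
  a *ℚ ℕ→ℚ (b + c) +ℚ dot r (x ⊕ y)
    ≡⟨ cong₂ _+ℚ_ (trans (cong (a *ℚ_) (ℕ→ℚ-+ b c)) (ℚ.*-distribˡ-+ a (ℕ→ℚ b) (ℕ→ℚ c))) (dot-⊕ r x y) ⟩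
  (a *ℚ ℕ→ℚ b +ℚ a *ℚ ℕ→ℚ c) +ℚ (dot r x +ℚ dot r y)
    ≡⟨ ℚ+.interchange (a *ℚ ℕ→ℚ b) (a *ℚ ℕ→ℚ c) (dot r x) (dot r y) ⟩
  (a *ℚ ℕ→ℚ b +ℚ dot r x) +ℚ (a *ℚ ℕ→ℚ c +ℚ dot r y) ∎
  where
  open ≡-Reasoning
  module ℚ+ = Algebra.Properties.CommutativeSemigroup
                (CommutativeMonoid.commutativeSemigroup ℚ.+-0-commutativeMonoid)

inK-cancelˡ : (A : Matrix m n) → InK A x → InK A (x ⊕ y) → InK A y
inK-cancelˡ {x = x} {y} A xK x⊕yK i = begin
  dot r y            ≡⟨ ℚ.+-identityˡ (dot r y) ⟨
  0ℚ +ℚ dot r y      ≡⟨ cong (_+ℚ dot r y) (xK i) ⟨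
  dot r x +ℚ dot r y ≡⟨ dot-⊕ r x y ⟨
  dot r (x ⊕ y)      ≡⟨ x⊕yK i ⟩
  0ℚ                 ∎
  where
  open ≡-Reasoning
  r = lookup A i

leOnes∧suppSub⇒≤ : (x y : Vec ℕ n) → LeOnes x → SuppSub x y → ∀ i → lookup x i ≤ lookup y i
leOnes∧suppSub⇒≤ x y x≤e supp i = ≤1∧pos⇒≤ (x≤e i) (supp i)
  where
  ≤1∧pos⇒≤ : ∀ {a b} → a ≤ 1 → (0 < a → 0 < b) → a ≤ b
  ≤1∧pos⇒≤ {zero} _ _ = z≤n
  ≤1∧pos⇒≤ {suc zero} _ 0<b = 0<b (s≤s z≤n)
  ≤1∧pos⇒≤ {suc (suc _)} (s≤s ()) _

theorem5 : ∀ {m n} (A : Matrix m n) (H : List (Vec ℕ n)) →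
    IsMinimalHilbertBasis A H →
    ∀ (v : Vec ℕ n) → v ∈ H → LeOnes v →
    ¬ (Σ (Vec ℕ n) λ u → u ∈ H × u ≢ v × SuppSub v u)
theorem5 A H isMHB@((H⊆K , _) , _) v v∈H v≤e (u , u∈H , u≢v , supp) =
  let w , u≡v⊕w = ≤-pointwise⇒∃⊕ v u (leOnes∧suppSub⇒≤ v u v≤e supp)
      vK = All.lookup H⊆K v∈H
      wK = inK-cancelˡ A vK (subst (InK A) u≡v⊕w (All.lookup H⊆K u∈H))
  in [ (λ v≡0ᵥ → minimal⇒0ᵥ∉ A isMHB (subst (_∈ H) v≡0ᵥ v∈H))
     , (λ w≡0ᵥ → u≢v (trans u≡v⊕w (trans (cong (v ⊕_) w≡0ᵥ) (⊕-identityʳ v))))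
     ] (minimal⇒irreducible A isMHB u∈H vK wK u≡v⊕w)
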